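{- Let $G$ be a finite group and let $H\leq A\leq G$. Let $X$ be a left transversal of $A$ in $G$. If $XH=HX^{ -1}$, then $\{aH: a\in A\}$ is a perfect code of the coset graph $\mathrm{Cos}(G,H,U)$, where $U=H(X\setminus A)H$.
   Context: All groups are finite. For a group $G$ and a subgroup $H$, let $U\subseteq G$ be a union of double cosets $HgH$ of $H$ in $G$ such that $H\cap U=\emptyset$ and $U^{ -1}=U$. The coset graph $\mathrm{Cos}(G,H,U)$ has vertex set $\{gH: g\in G\}$, and $g_1H$, $g_2H$ are adjacent iff $g_1^{ -1}g_2\in U$. A perfect code in a graph $\Gamma$ is an independent set $C$ of vertices such that every vertex outside $C$ is adjacent to exactly one vertex of $C$. A left transversal of $A$ in $G$ is a subset of $G$ containing exactly one element from each left coset $gA$. For subsets $X,Y\subseteq G$, $XY=\{xy: x\in X,y\in Y\}$ and $X^{ -1}=\{x^{ -1}:x\in X\}$. -}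

module Defs where

open import Level using (Level; _⊔_)
open import Algebra.Bundles using (Group)
open import Data.Nat using (ℕ)
open import Data.Fin using (Fin)
open import Data.Empty using (⊥)
open import Data.Product using (Σ; ∃; ∃-syntax; _×_; _,_)
open import Relation.Nullary using (¬_)
open import Relation.Unary using (Pred; _⊆_)

module _ {c ℓ : Level} (G : Group c ℓ) where
  open Group G

  Finite : Set (c ⊔ ℓ)
  Finite = Σ ℕ λ n → Σ (Fin n → Carrier) λ f → ∀ g → ∃[ i ] (f i ≈ g)

  RespectsEq : {p : Level} → Pred Carrier p → Set (c ⊔ ℓ ⊔ p)
  RespectsEq S = ∀ {x y} → x ≈ y → S x → S y

  record IsSubgroup {p : Level} (H : Pred Carrier p) : Set (c ⊔ ℓ ⊔ p) where
    field
      resp   : RespectsEq H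
      has-ε  : H ε
      ∙-closed : ∀ {x y} → H x → H y → H (x ∙ y)
      ⁻¹-closed : ∀ {x} → H x → H (x ⁻¹)

  _≐_ : {p q : Level} → Pred Carrier p → Pred Carrier q → Set (c ⊔ p ⊔ q)
  S ≐ T = (S ⊆ T) × (T ⊆ S)

  Prod : {p q : Level} → Pred Carrier p → Pred Carrier q → Pred Carrier (c ⊔ ℓ ⊔ p ⊔ q)
  Prod S T g = ∃[ s ] ∃[ t ] (S s × T t × g ≈ s ∙ t)

  Inv : {p : Level} → Pred Carrier p → Pred Carrier (c ⊔ ℓ ⊔ p)
  Inv S g = ∃[ s ] (S s × g ≈ s ⁻¹)

  Diff : {p q : Level} → Pred Carrier p → Pred Carrier q → Pred Carrier (p ⊔ q)
  Diff S T x = S x × ¬ T x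

  -- X is a left transversal of A in G: X meets every left coset gA in exactly one element
  -- (x ∈ gA  ⇔  g⁻¹x ∈ A)
  record IsLeftTransversal {p q : Level} (A : Pred Carrier p) (X : Pred Carrier q) : Set (c ⊔ ℓ ⊔ p ⊔ q) where
    field
      resp  : RespectsEq X
      meets : ∀ g → ∃[ x ] (X x × A (g ⁻¹ ∙ x))
      unique : ∀ g x y → X x → X y → A (g ⁻¹ ∙ x) → A (g ⁻¹ ∙ y) → x ≈ y

  -- Coset graph Cos(G,H,U): vertices are left cosets gH, represented by g;
  -- g₁H and g₂H are the same vertex iff g₁⁻¹g₂ ∈ H, adjacent iff g₁⁻¹g₂ ∈ U.
  SameVertex : {p : Level} → Pred Carrier p → Carrier → Carrier → Set p
  SameVertex H g₁ g₂ = H (g₁ ⁻¹ ∙ g₂)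

  Adj : {q : Level} → Pred Carrier q → Carrier → Carrier → Set q
  Adj U g₁ g₂ = U (g₁ ⁻¹ ∙ g₂)

  record IsConnectionSet {p q : Level} (H : Pred Carrier p) (U : Pred Carrier q) : Set (c ⊔ ℓ ⊔ p ⊔ q) where
    field
      resp : RespectsEq U
      double-coset-union : ∀ {h₁ u h₂} → H h₁ → U u → H h₂ → U (h₁ ∙ u ∙ h₂)
      disjoint : ∀ g → H g → U g → ⊥
      symmetric : Inv U ≐ U

  -- C (given as the predicate "gH ∈ C" on representatives) is a perfect code of Cos(G,H,U)
  record IsPerfectCode {p q r : Level} (H : Pred Carrier p) (U : Pred Carrier q) (C : Pred Carrier r) : Set (c ⊔ ℓ ⊔ p ⊔ q ⊔ r) where
    field
      independent : ∀ g₁ g₂ → C g₁ → C g₂ → ¬ Adj U g₁ g₂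
      dominating  : ∀ g → ¬ C g → ∃[ v ] (C v × Adj U g v)
      unique      : ∀ g → ¬ C g → ∀ v w → C v → C w → Adj U g v → Adj U g w → SameVertex H v w

  CosetsOf : {p q : Level} → Pred Carrier p → Pred Carrier q → Pred Carrier (c ⊔ p ⊔ q)
  CosetsOf H A g = ∃[ a ] (A a × SameVertex H a g)

module Submission where

-- For x ∈ X ∖ A, the hypothesis XH ⊆ HX⁻¹ writes x = k y⁻¹ with y ∈ X ∖ A, so (X ∖ A)⁻¹ ⊆ (X ∖ A)H;
-- hence U = H(X ∖ A)H is closed under inversion, and U ⊆ HX⁻¹ gives U ⊆ XH.  Since H ≤ A, U misses A,
-- so the vertices aH are pairwise non-adjacent.  A vertex gH with g ∉ A is adjacent to gxH ⊆ A, where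
-- x is the point of X in gA, and g⁻¹v = yk ∈ XH for any neighbour v ∈ A forces y to be that same point,
-- which pins down vH.

open import Level using (Level; _⊔_)
open import Algebra.Bundles using (Group)
open import Data.Product using (_×_; _,_; proj₁; proj₂; ∃-syntax)
open import Relation.Unary using (Pred; _⊆_)
open import Relation.Nullary using (¬_)
open import Function using (id)
open import Defs
import Algebra.Properties.Group as GroupProperties
import Relation.Binary.Reasoning.Setoid as SetoidReasoning

module _ {c ℓ : Level} (G : Group c ℓ) where
  open Group G
  open GroupProperties G
  open SetoidReasoning setoid

  module _ {p : Level} {A : Pred Carrier p} (sA : IsSubgroup G A) where
    open IsSubgroup sA

    ∈-⁻¹∙-closed : ∀ {x y} → A x → A y → A (x ⁻¹ ∙ y)
    ∈-⁻¹∙-closed ax ay = ∙-closed (⁻¹-closed ax) ay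

    ∈-cancelˡ : ∀ {x y} → A x → A (x ∙ y) → A y
    ∈-cancelˡ {x} {y} ax axy = resp (\\-leftDividesʳ x y) (∈-⁻¹∙-closed ax axy)

    ∈-cancelʳ : ∀ {x y} → A y → A (x ∙ y) → A x
    ∈-cancelʳ {x} {y} ay axy = resp (//-rightDividesʳ y x) (∙-closed axy (⁻¹-closed ay))

    sameVertex-intro : ∀ {v w a b} → A a → A b → v ∙ a ≈ w ∙ b → SameVertex G A v w
    sameVertex-intro {v} {w} {a} {b} aa ab va≈wb =
      resp (sym v⁻¹w≈ab⁻¹) (∙-closed aa (⁻¹-closed ab))
      where
      v⁻¹w≈ab⁻¹ : v ⁻¹ ∙ w ≈ a ∙ b ⁻¹
      v⁻¹w≈ab⁻¹ = begin
        v ⁻¹ ∙ w                ≈⟨ ∙-congˡ (x≈z//y w b (v ∙ a) (sym va≈wb)) ⟩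
        v ⁻¹ ∙ (v ∙ a ∙ b ⁻¹)   ≈⟨ ∙-congˡ (assoc v a (b ⁻¹)) ⟩
        v ⁻¹ ∙ (v ∙ (a ∙ b ⁻¹)) ≈⟨ \\-leftDividesʳ v (a ∙ b ⁻¹) ⟩
        a ∙ b ⁻¹                ∎

    CosetsOf⊆ : ∀ {r} {H : Pred Carrier r} → H ⊆ A → CosetsOf G H A ⊆ A
    CosetsOf⊆ H⊆A (a , aa , a⁻¹g∈H) = ∈-cancelˡ (⁻¹-closed aa) (H⊆A a⁻¹g∈H)

    ⊆CosetsOf : ∀ {r} {H : Pred Carrier r} → IsSubgroup G H → A ⊆ CosetsOf G H A
    ⊆CosetsOf sH {g} ag = g , ag , IsSubgroup.resp sH (sym (inverseˡ g)) (IsSubgroup.has-ε sH)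

  module _ {p q : Level} {A : Pred Carrier p} {X : Pred Carrier q}
           (sA : IsSubgroup G A) (T : IsLeftTransversal G A X) where
    private
      module T = IsLeftTransversal T
      g⁻¹⁻¹≈g : ∀ g {x} → g ⁻¹ ⁻¹ ∙ x ≈ g ∙ x
      g⁻¹⁻¹≈g g = ∙-congʳ (⁻¹-involutive g)

    transversal-meets : ∀ g → ∃[ x ] (X x × A (g ∙ x))
    transversal-meets g with T.meets (g ⁻¹)
    ... | x , xx , ax = x , xx , IsSubgroup.resp sA (g⁻¹⁻¹≈g g) ax

    transversal-unique : ∀ g {x y} → X x → X y → A (g ∙ x) → A (g ∙ y) → x ≈ y
    transversal-unique g {x} {y} xx xy ax ay = T.unique (g ⁻¹) x y xx xy
      (IsSubgroup.resp sA (sym (g⁻¹⁻¹≈g g)) ax) (IsSubgroup.resp sA (sym (g⁻¹⁻¹≈g g)) ay)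

  Prod-resp : ∀ {p q} {S : Pred Carrier p} {T : Pred Carrier q} → RespectsEq G (Prod G S T)
  Prod-resp x≈y (s , t , ss , tt , x≈st) = s , t , ss , tt , trans (sym x≈y) x≈st

  Prod-monoˡ : ∀ {p p′ q} {S : Pred Carrier p} {S′ : Pred Carrier p′} {T : Pred Carrier q} →
               S ⊆ S′ → Prod G S T ⊆ Prod G S′ T
  Prod-monoˡ S⊆S′ (s , t , ss , tt , x≈st) = s , t , S⊆S′ ss , tt , x≈st

  ⁻¹-closed⇒Inv-≐ : ∀ {p} {S : Pred Carrier p} → RespectsEq G S →
                    (∀ {x} → S x → S (x ⁻¹)) → _≐_ G (Inv G S) S
  ⁻¹-closed⇒Inv-≐ resp closed =
      (λ { (s , ss , x≈s⁻¹) → resp (sym x≈s⁻¹) (closed ss) })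
    , (λ {x} sx → x ⁻¹ , closed sx , sym (⁻¹-involutive x))

  ⁻¹-closed-⊆HX⁻¹⇒⊆XH : ∀ {p q r} {H : Pred Carrier p} {X : Pred Carrier q} {U : Pred Carrier r} →
                         IsSubgroup G H → (∀ {u} → U u → U (u ⁻¹)) →
                         U ⊆ Prod G H (Inv G X) → U ⊆ Prod G X H
  ⁻¹-closed-⊆HX⁻¹⇒⊆XH sH closed U⊆HX⁻¹ {u} uu with U⊆HX⁻¹ (closed uu)
  ... | k , y⁻¹ , hk , (y , xy , y⁻¹≈) , u⁻¹≈ky⁻¹ =
    y , k ⁻¹ , xy , IsSubgroup.⁻¹-closed sH hk , u≈yk⁻¹
    where
    u≈yk⁻¹ : u ≈ y ∙ k ⁻¹
    u≈yk⁻¹ = begin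
      u               ≈⟨ ⁻¹-involutive u ⟨
      u ⁻¹ ⁻¹         ≈⟨ ⁻¹-cong (trans u⁻¹≈ky⁻¹ (∙-congˡ y⁻¹≈)) ⟩
      (k ∙ y ⁻¹) ⁻¹   ≈⟨ ⁻¹-anti-homo-// k y ⟩
      y ∙ k ⁻¹        ∎

  module _ {p q : Level} {H : Pred Carrier p} {S : Pred Carrier q} (sH : IsSubgroup G H) where
    private
      module H = IsSubgroup sH

    record DoubleCosetWitness (u : Carrier) : Set (c ⊔ ℓ ⊔ p ⊔ q) where
      constructor witness
      field
        {h x t} : Carrier
        h∈H : H h
        x∈S : S x
        t∈H : H t
        u≈hxt : u ≈ h ∙ x ∙ t

    ∈-doubleCoset : ∀ {u} → DoubleCosetWitness u → Prod G (Prod G H S) H u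
    ∈-doubleCoset (witness {h} {x} {t} hh sx ht u≈hxt) = h ∙ x , t , (h , x , hh , sx , refl) , ht , u≈hxt

    doubleCoset-witness : ∀ {u} → Prod G (Prod G H S) H u → DoubleCosetWitness u
    doubleCoset-witness (_ , _ , (_ , _ , hh , sx , s≈hx) , ht , u≈st) =
      witness hh sx ht (trans u≈st (∙-congʳ s≈hx))

    S⊆doubleCoset : S ⊆ Prod G (Prod G H S) H
    S⊆doubleCoset {x} sx = ∈-doubleCoset (witness H.has-ε sx H.has-ε (begin
      x           ≈⟨ identityˡ x ⟨
      ε ∙ x       ≈⟨ identityʳ (ε ∙ x) ⟨
      ε ∙ x ∙ ε   ∎))

    doubleCoset-absorbs : ∀ {h₁ u h₂} → H h₁ → Prod G (Prod G H S) H u → H h₂ →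
                          Prod G (Prod G H S) H (h₁ ∙ u ∙ h₂)
    doubleCoset-absorbs {h₁} {u} {h₂} hh₁ hsh hh₂ with doubleCoset-witness hsh
    ... | witness {h} {x} {t} hh sx ht u≈hxt =
      ∈-doubleCoset (witness (H.∙-closed hh₁ hh) sx (H.∙-closed ht hh₂) (begin
        h₁ ∙ u ∙ h₂               ≈⟨ ∙-congʳ (∙-congˡ u≈hxt) ⟩
        h₁ ∙ (h ∙ x ∙ t) ∙ h₂     ≈⟨ ∙-congʳ (assoc h₁ (h ∙ x) t) ⟨
        h₁ ∙ (h ∙ x) ∙ t ∙ h₂     ≈⟨ assoc (h₁ ∙ (h ∙ x)) t h₂ ⟩
        h₁ ∙ (h ∙ x) ∙ (t ∙ h₂)   ≈⟨ ∙-congʳ (assoc h₁ h x) ⟨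
        h₁ ∙ h ∙ x ∙ (t ∙ h₂)     ∎))

    doubleCoset-disjoint : ∀ {r} {A : Pred Carrier r} → IsSubgroup G A → H ⊆ A →
                           (∀ {x} → S x → ¬ A x) → ∀ {u} → Prod G (Prod G H S) H u → ¬ A u
    doubleCoset-disjoint sA H⊆A S∩A=∅ hsh au with doubleCoset-witness hsh
    ... | witness hh sx ht u≈hxt =
      S∩A=∅ sx (∈-cancelˡ sA (H⊆A hh) (∈-cancelʳ sA (H⊆A ht) (IsSubgroup.resp sA u≈hxt au)))

    doubleCoset-⁻¹-closed : (∀ {x} → S x → Prod G S H (x ⁻¹)) →
                            ∀ {u} → Prod G (Prod G H S) H u → Prod G (Prod G H S) H (u ⁻¹)
    doubleCoset-⁻¹-closed S⁻¹⊆SH {u} hsh with doubleCoset-witness hsh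
    ... | witness {h} {x} {t} hh sx ht u≈hxt with S⁻¹⊆SH sx
    ...   | s , k , ss , hk , x⁻¹≈sk =
      ∈-doubleCoset (witness (H.⁻¹-closed ht) ss (H.∙-closed hk (H.⁻¹-closed hh)) (begin
        u ⁻¹                        ≈⟨ ⁻¹-cong u≈hxt ⟩
        (h ∙ x ∙ t) ⁻¹              ≈⟨ ⁻¹-anti-homo-∙ (h ∙ x) t ⟩
        t ⁻¹ ∙ (h ∙ x) ⁻¹           ≈⟨ ∙-congˡ (⁻¹-anti-homo-∙ h x) ⟩
        t ⁻¹ ∙ (x ⁻¹ ∙ h ⁻¹)        ≈⟨ ∙-congˡ (∙-congʳ x⁻¹≈sk) ⟩
        t ⁻¹ ∙ (s ∙ k ∙ h ⁻¹)       ≈⟨ ∙-congˡ (assoc s k (h ⁻¹)) ⟩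
        t ⁻¹ ∙ (s ∙ (k ∙ h ⁻¹))     ≈⟨ assoc (t ⁻¹) s (k ∙ h ⁻¹) ⟨
        t ⁻¹ ∙ s ∙ (k ∙ h ⁻¹)       ∎))

    doubleCoset⊆ : ∀ {r} {T : Pred Carrier r} →
                   Prod G S H ⊆ Prod G H T → Prod G (Prod G H S) H ⊆ Prod G H T
    doubleCoset⊆ SH⊆HT {u} hsh with doubleCoset-witness hsh
    ... | witness {h} {x} {t} hh sx ht u≈hxt with SH⊆HT (x , t , sx , ht , refl)
    ...   | k , y , hk , ty , xt≈ky = h ∙ k , y , H.∙-closed hh hk , ty , (begin
        u             ≈⟨ u≈hxt ⟩
        h ∙ x ∙ t     ≈⟨ assoc h x t ⟩
        h ∙ (x ∙ t)   ≈⟨ ∙-congˡ xt≈ky ⟩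
        h ∙ (k ∙ y)   ≈⟨ assoc h k y ⟨
        h ∙ k ∙ y     ∎)

    doubleCoset-isConnectionSet : (∀ {x} → S x → ¬ H x) → (∀ {x} → S x → Prod G S H (x ⁻¹)) →
                                  IsConnectionSet G H (Prod G (Prod G H S) H)
    doubleCoset-isConnectionSet S∩H=∅ S⁻¹⊆SH = record
      { resp               = Prod-resp
      ; double-coset-union = doubleCoset-absorbs
      ; disjoint           = λ g hg hsh → doubleCoset-disjoint sH id S∩H=∅ hsh hg
      ; symmetric          = ⁻¹-closed⇒Inv-≐ Prod-resp (doubleCoset-⁻¹-closed S⁻¹⊆SH)
      }

  X∖A⁻¹⊆X∖A·H : ∀ {p q r} {H : Pred Carrier p} {A : Pred Carrier q} {X : Pred Carrier r} →
                IsSubgroup G H → IsSubgroup G A → H ⊆ A → Prod G X H ⊆ Prod G H (Inv G X) →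
                ∀ {x} → Diff G X A x → Prod G (Diff G X A) H (x ⁻¹)
  X∖A⁻¹⊆X∖A·H {A = A} sH sA H⊆A XH⊆HX⁻¹ {x} (xx , x∉A)
    with XH⊆HX⁻¹ (x , ε , xx , IsSubgroup.has-ε sH , sym (identityʳ x))
  ... | k , y⁻¹ , hk , (y , xy , y⁻¹≈) , x≈ky⁻¹′ =
    y , k ⁻¹ , (xy , y∉A) , IsSubgroup.⁻¹-closed sH hk , x⁻¹≈yk⁻¹
    where
    x≈ky⁻¹ : x ≈ k ∙ y ⁻¹
    x≈ky⁻¹ = trans x≈ky⁻¹′ (∙-congˡ y⁻¹≈)
    y∉A : ¬ A y
    y∉A ay = x∉A (IsSubgroup.resp sA (sym x≈ky⁻¹)
                   (IsSubgroup.∙-closed sA (H⊆A hk) (IsSubgroup.⁻¹-closed sA ay)))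
    x⁻¹≈yk⁻¹ : x ⁻¹ ≈ y ∙ k ⁻¹
    x⁻¹≈yk⁻¹ = trans (⁻¹-cong x≈ky⁻¹) (⁻¹-anti-homo-// k y)

  module _ {p q r s : Level}
           {H : Pred Carrier p} {A : Pred Carrier q} {X : Pred Carrier r} {U : Pred Carrier s}
           (sH : IsSubgroup G H) (sA : IsSubgroup G A) (H⊆A : H ⊆ A) (T : IsLeftTransversal G A X)
           (U-resp : RespectsEq G U) (U∩A=∅ : ∀ {u} → U u → ¬ A u)
           (X∖A⊆U : Diff G X A ⊆ U) (U⊆XH : U ⊆ Prod G X H) where

    CosetsOf-independent : ∀ g₁ g₂ → CosetsOf G H A g₁ → CosetsOf G H A g₂ → ¬ Adj G U g₁ g₂
    CosetsOf-independent _ _ c₁ c₂ adj =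
      U∩A=∅ adj (∈-⁻¹∙-closed sA (CosetsOf⊆ sA H⊆A c₁) (CosetsOf⊆ sA H⊆A c₂))

    CosetsOf-dominating : ∀ g → ¬ CosetsOf G H A g → ∃[ v ] (CosetsOf G H A v × Adj G U g v)
    CosetsOf-dominating g g∉C with transversal-meets sA T g
    ... | x , xx , agx =
      g ∙ x , ⊆CosetsOf sA sH agx , U-resp (sym (\\-leftDividesʳ g x)) (X∖A⊆U (xx , x∉A))
      where
      x∉A : ¬ A x
      x∉A ax = g∉C (⊆CosetsOf sA sH (∈-cancelʳ sA ax agx))

    private
      neighbour-transversal : ∀ g v → A v → Adj G U g v →
                              ∃[ y ] ∃[ k ] (X y × H k × A (g ∙ y) × g ∙ y ≈ v ∙ k ⁻¹)
      neighbour-transversal g v av adj with U⊆XH adj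
      ... | y , k , xy , hk , g⁻¹v≈yk = y , k , xy , hk , agy , gy≈vk⁻¹
        where
        gy≈vk⁻¹ : g ∙ y ≈ v ∙ k ⁻¹
        gy≈vk⁻¹ = x≈z//y (g ∙ y) k v (begin
          g ∙ y ∙ k         ≈⟨ assoc g y k ⟩
          g ∙ (y ∙ k)       ≈⟨ ∙-congˡ g⁻¹v≈yk ⟨
          g ∙ (g ⁻¹ ∙ v)    ≈⟨ \\-leftDividesˡ g v ⟩
          v                 ∎)
        agy : A (g ∙ y)
        agy = IsSubgroup.resp sA (sym gy≈vk⁻¹)
                (IsSubgroup.∙-closed sA av (IsSubgroup.⁻¹-closed sA (H⊆A hk)))

    CosetsOf-unique : ∀ g → ¬ CosetsOf G H A g → ∀ v w → CosetsOf G H A v → CosetsOf G H A w →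
                      Adj G U g v → Adj G U g w → SameVertex G H v w
    CosetsOf-unique g _ v w cv cw adjv adjw
      with neighbour-transversal g v (CosetsOf⊆ sA H⊆A cv) adjv
         | neighbour-transversal g w (CosetsOf⊆ sA H⊆A cw) adjw
    ... | y , k , xy , hk , agy , gy≈vk⁻¹ | y′ , k′ , xy′ , hk′ , agy′ , gy′≈wk′⁻¹ =
      sameVertex-intro sH (IsSubgroup.⁻¹-closed sH hk) (IsSubgroup.⁻¹-closed sH hk′) (begin
        v ∙ k ⁻¹     ≈⟨ gy≈vk⁻¹ ⟨
        g ∙ y        ≈⟨ ∙-congˡ (transversal-unique sA T g xy xy′ agy agy′) ⟩
        g ∙ y′       ≈⟨ gy′≈wk′⁻¹ ⟩
        w ∙ k′ ⁻¹    ∎)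

    CosetsOf-isPerfectCode : IsPerfectCode G H U (CosetsOf G H A)
    CosetsOf-isPerfectCode = record
      { independent = CosetsOf-independent
      ; dominating  = CosetsOf-dominating
      ; unique      = CosetsOf-unique
      }

corollary3p3 : {c ℓ p : Level} (G : Group c ℓ) → Finite G →
    (H A X : Pred (Group.Carrier G) p) →
    IsSubgroup G H → IsSubgroup G A → H ⊆ A →
    IsLeftTransversal G A X →
    _≐_ G (Prod G X H) (Prod G H (Inv G X)) →
    IsConnectionSet G H (Prod G (Prod G H (Diff G X A)) H)
    × IsPerfectCode G H (Prod G (Prod G H (Diff G X A)) H) (CosetsOf G H A)
corollary3p3 G _ H A X sH sA H⊆A T (XH⊆HX⁻¹ , _) =
    doubleCoset-isConnectionSet G sH (λ x∈X∖A x∈H → proj₂ x∈X∖A (H⊆A x∈H)) D⁻¹⊆DH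
  , CosetsOf-isPerfectCode G sH sA H⊆A T (Prod-resp G)
      (doubleCoset-disjoint G sH sA H⊆A proj₂)
      (S⊆doubleCoset G sH)
      (⁻¹-closed-⊆HX⁻¹⇒⊆XH G sH (doubleCoset-⁻¹-closed G sH D⁻¹⊆DH)
        (doubleCoset⊆ G sH (λ x∈X∖A·H → XH⊆HX⁻¹ (Prod-monoˡ G proj₁ x∈X∖A·H))))
  where
  open Group G using (_⁻¹)
  D⁻¹⊆DH : ∀ {x} → Diff G X A x → Prod G (Diff G X A) H (x ⁻¹)
  D⁻¹⊆DH = X∖A⁻¹⊆X∖A·H G sH sA H⊆A XH⊆HX⁻¹
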